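{- Let $M:\alpha\mapsto M_\alpha$ be a matroid flock on a finite set $E$, let $g$ be the unique function $\mathbb{Z}^E\to\mathbb{Z}$ with $g(0)=0$ and $g(\alpha+e_I)=g(\alpha)+r_\alpha(I)$ for all $\alpha\in\mathbb{Z}^E$, $I\subseteq E$, and let $f:\mathbb{Z}^E\to\mathbb{Z}\cup\{\infty\}$, $f(\omega)=\sup\{\omega^T\beta-g(\beta):\beta\in\mathbb{Z}^E\}$. For $\alpha,\omega\in\mathbb{Z}^E$ the following are equivalent: (1) $\omega^T\alpha=f(\omega)+g(\alpha)$; (2) $\omega=e_B$ for some basis $B$ of $M_\alpha$.
   Context: A matroid flock of rank $d$ on $E$ assigns to each $\alpha\in\mathbb{Z}^E$ a matroid $M_\alpha$ on $E$ of rank $d$ with $M_\alpha/i=M_{\alpha+e_i}\setminus i$ and $M_\alpha=M_{\alpha+\mathbf{1}}$ for all $\alpha\in\mathbb{Z}^E$, $i\in E$. $r_\alpha$ is the rank function of $M_\alpha$; $e_I=\sum_{i\in I}e_i$. -}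

module Defs where

open import Data.Nat as ℕ using (ℕ)
open import Data.Integer as ℤ using (ℤ; 0ℤ; 1ℤ)
open import Data.Bool using (Bool; if_then_else_)
open import Data.Fin using (Fin)
open import Data.Fin.Subset using (Subset; _∪_; _∩_; _⊆_; _∉_; ⁅_⁆; ⊤; ∣_∣)
open import Data.Vec using (Vec; []; _∷_; map; zipWith; replicate)
open import Data.Product using (_×_)
import Data.Unit as Unit
open import Data.Empty using (⊥)
open import Relation.Binary.PropositionalEquality using (_≡_)

-- Points of ℤ^E, with E = Fin n, are vectors of integers.
ZE : ℕ → Set
ZE n = Vec ℤ n

_⊕_ : ∀ {n} → ZE n → ZE n → ZE n
_⊕_ = zipWith ℤ._+_

𝟎 : ∀ {n} → ZE n
𝟎 = replicate _ 0ℤ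

𝟏 : ∀ {n} → ZE n
𝟏 = replicate _ 1ℤ

e : ∀ {n} → Subset n → ZE n
e = map (λ b → if b then 1ℤ else 0ℤ)

eᵢ : ∀ {n} → Fin n → ZE n
eᵢ i = e ⁅ i ⁆

dot : ∀ {n} → ZE n → ZE n → ℤ
dot [] [] = 0ℤ
dot (x ∷ xs) (y ∷ ys) = x ℤ.* y ℤ.+ dot xs ys

record Matroid (n : ℕ) : Set where
  field
    rank      : Subset n → ℕ
    rank-≤    : ∀ X → rank X ℕ.≤ ∣ X ∣
    rank-mono : ∀ X Y → X ⊆ Y → rank X ℕ.≤ rank Y
    rank-sub  : ∀ X Y → rank (X ∪ Y) ℕ.+ rank (X ∩ Y) ℕ.≤ rank X ℕ.+ rank Y
open Matroid public

rk : ∀ {n} → Matroid n → ℕ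
rk M = rank M ⊤

Independent : ∀ {n} → Matroid n → Subset n → Set
Independent M I = rank M I ≡ ∣ I ∣

IsBasis : ∀ {n} → Matroid n → Subset n → Set
IsBasis M B = Independent M B × (∀ J → B ⊆ J → Independent M J → J ≡ B)

-- Contraction M/i and deletion M∖i are matroids on E - i; a subset of E - i
-- is represented as a subset J of E with i ∉ J.
contractRank : ∀ {n} → Matroid n → Fin n → Subset n → ℕ
contractRank M i J = rank M (J ∪ ⁅ i ⁆) ℕ.∸ rank M ⁅ i ⁆

deleteRank : ∀ {n} → Matroid n → Fin n → Subset n → ℕ
deleteRank M i J = rank M J

record IsFlock {n : ℕ} (d : ℕ) (M : ZE n → Matroid n) : Set where
  field
    flock-rank     : ∀ α → rk (M α) ≡ d
    flock-contract : ∀ α i J → i ∉ J →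
                     contractRank (M α) i J ≡ deleteRank (M (α ⊕ eᵢ i)) i J
    flock-period   : ∀ α J → rank (M α) J ≡ rank (M (α ⊕ 𝟏)) J
open IsFlock public

data ℤ∞ : Set where
  fin : ℤ → ℤ∞
  ∞   : ℤ∞

_≤∞_ : ℤ∞ → ℤ∞ → Set
fin a ≤∞ fin b = a ℤ.≤ b
fin a ≤∞ ∞     = Unit.⊤
∞     ≤∞ fin b = ⊥
∞     ≤∞ ∞     = Unit.⊤

_+∞_ : ℤ∞ → ℤ → ℤ∞
fin a +∞ b = fin (a ℤ.+ b)
∞     +∞ b = ∞

IsSup : ∀ {n} → (ZE n → ℤ) → ℤ∞ → Set
IsSup h s = (∀ β → fin (h β) ≤∞ s) × (∀ u → (∀ β → fin (h β) ≤∞ u) → s ≤∞ u)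

module Submission where

-- Write h_ω(β) = ω·β − g(β).  The equation says precisely that α maximises
-- h_ω (the supremum is attained at α), so the theorem is a characterisation
-- of the maximisers of h_ω, derived from the increment rule for g alone:
--  * maximiser ⇒ basis: comparing α with α ± e_I gives
--    r_{α−e_I}(I) ≤ ω·e_I ≤ r_α(I).  Singletons force ω = e_B; then I = B
--    makes B independent and I = E gives |B| ≥ d, so B is a basis.
--  * basis ⇒ maximiser: every β satisfies β + K·𝟏 = α + δ with δ ∈ ℕ^E.
--    Peeling δ layer by layer, the rank-shift inequality
--    r_α(J ∩ I) ≤ r_{α+e_I}(J) yields g(α) + e_B·δ ≤ g(α + δ) for every
--    independent B of M_α; with g(β + K·𝟏) = g(β) + K d and d ≤ |B| this
--    gives h(β) ≤ h(α).

open import Defs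
open import Data.Nat using (ℕ)
open import Data.Integer using (ℤ; 0ℤ; _+_; _-_; +_)
open import Data.Fin.Subset using (Subset)
open import Data.Product using (Σ; _×_)
open import Function.Bundles using (_⇔_)
open import Relation.Binary.PropositionalEquality using (_≡_)

import Data.Nat as ℕ
open import Data.Nat using (zero; suc; z≤n)
import Data.Nat.Properties as ℕP
import Data.Integer as ℤ
open import Data.Integer using (-[1+_]; 1ℤ; -_; _*_; +≤+)
import Data.Integer.Properties as ℤP
open import Data.Integer.Tactic.RingSolver using (solve-∀)
open import Data.Bool using (Bool; true; false; _∨_; if_then_else_)
open import Data.Fin using (Fin)
import Data.Fin as Fin
open import Data.Fin.Subset using (_∩_; _∪_; ∁; ⁅_⁆; ∣_∣; _⊆_; _∈_; ⊤; ⊥; ⋃)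
import Data.Fin.Subset.Properties as SP
open import Data.Vec using (Vec; []; _∷_; zipWith; map; replicate; lookup; here)
import Data.Vec.Properties as VP
open import Data.Vec.Relation.Unary.All using (All; []; _∷_)
import Data.List as List
import Data.List.Membership.Propositional as List
import Data.List.Membership.Propositional.Properties as ListP
import Data.List.Relation.Unary.Any as Any
open import Data.Product using (_,_; proj₁)
open import Relation.Nullary using (yes; no; contradiction)
open import Function.Bundles using (mk⇔)
open import Function.Construct.Composition using (_⇔-∘_)
open import Relation.Binary.PropositionalEquality
  using (refl; sym; trans; cong; cong₂; subst; subst₂; module ≡-Reasoning)

+-sub-cancel : ∀ x c → x + c - c ≡ x
+-sub-cancel = solve-∀

sub-+-cancel : ∀ x c → x - c + c ≡ x
sub-+-cancel = solve-∀

neg-+-cancel : ∀ a x → - a + (a + x) ≡ x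
neg-+-cancel = solve-∀

+-cancelˡ-≡ : ∀ a {x y} → a + x ≡ a + y → x ≡ y
+-cancelˡ-≡ a {x} {y} eq =
  subst₂ _≡_ (neg-+-cancel a x) (neg-+-cancel a y) (cong (λ t → - a + t) eq)

+-cancelˡ-≤ : ∀ a {x y} → a + x ℤ.≤ a + y → x ℤ.≤ y
+-cancelˡ-≤ a {x} {y} le =
  subst₂ ℤ._≤_ (neg-+-cancel a x) (neg-+-cancel a y) (ℤP.+-monoʳ-≤ (- a) le)

exchange-bound : ∀ {a c p q s u v} → a + p ≡ c + q → u + q ℤ.≤ v + s → s ℤ.≤ p →
                 a - v ℤ.≤ c - u
exchange-bound {a} {c} {p} {q} {s} {u} {v} eq growth s≤p = begin
  a - v              ≡⟨ add-both a v p ⟩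
  (a + p) - (v + p)  ≡⟨ cong (_- (v + p)) eq ⟩
  (c + q) - (v + p)  ≤⟨ ℤP.+-monoʳ-≤ (c + q) (ℤP.neg-mono-≤ (ℤP.+-monoʳ-≤ v s≤p)) ⟩
  (c + q) - (v + s)  ≤⟨ ℤP.+-monoʳ-≤ (c + q) (ℤP.neg-mono-≤ growth) ⟩
  (c + q) - (u + q)  ≡⟨ sym (add-both c u q) ⟩
  c - u              ∎
  where
  open ℤP.≤-Reasoning
  add-both : ∀ x y z → x - y ≡ (x + z) - (y + z)
  add-both = solve-∀

Maximises : ∀ {n} → (ZE n → ℤ) → ZE n → Set
Maximises h α = ∀ β → h β ℤ.≤ h α

fin-injective : ∀ {x y} → fin x ≡ fin y → x ≡ y
fin-injective refl = refl

≤∞-antisym : ∀ {s x} → s ≤∞ fin x → fin x ≤∞ s → s ≡ fin x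
≤∞-antisym {fin y} s≤x x≤s = cong fin (ℤP.≤-antisym s≤x x≤s)
≤∞-antisym {∞} () _

sup-attained : ∀ {n} {h : ZE n → ℤ} {s} → IsSup h s → ∀ α →
               (s ≡ fin (h α)) ⇔ Maximises h α
sup-attained {h = h} (upper , least) α = mk⇔
  (λ s≡hα β → subst (fin (h β) ≤∞_) s≡hα (upper β))
  (λ maximum → ≤∞-antisym (least (fin (h α)) maximum) (upper α))

+∞-solve : ∀ s x c → (fin x ≡ s +∞ c) ⇔ (s ≡ fin (x - c))
+∞-solve ∞       x c = mk⇔ (λ ()) (λ ())
+∞-solve (fin y) x c = mk⇔
  (λ x≡y+c → cong fin (trans (sym (+-sub-cancel y c)) (cong (_- c) (sym (fin-injective x≡y+c)))))
  (λ y≡x-c → cong fin (trans (sym (sub-+-cancel x c)) (cong (_+ c) (sym (fin-injective y≡x-c)))))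

⊕-assoc : ∀ {n} (a b c : ZE n) → (a ⊕ b) ⊕ c ≡ a ⊕ (b ⊕ c)
⊕-assoc = VP.zipWith-assoc ℤP.+-assoc

⊕-identityʳ : ∀ {n} (a : ZE n) → a ⊕ 𝟎 ≡ a
⊕-identityʳ = VP.zipWith-identityʳ ℤP.+-identityʳ

_⊟_ : ∀ {n} → ZE n → ZE n → ZE n
_⊟_ = zipWith _-_

⊟-⊕ : ∀ {n} (a b : ZE n) → (a ⊟ b) ⊕ b ≡ a
⊟-⊕ []      []      = refl
⊟-⊕ (x ∷ a) (y ∷ b) = cong₂ _∷_ (sub-+-cancel x y) (⊟-⊕ a b)

constᵥ : ∀ {n} → ℕ → ZE n
constᵥ K = replicate _ (+ K)

constᵥ-suc : ∀ {n} K → constᵥ {n} (suc K) ≡ 𝟏 ⊕ constᵥ K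
constᵥ-suc K = sym (VP.zipWith-replicate _+_ 1ℤ (+ K))

dot-⊕ʳ : ∀ {n} (w a b : ZE n) → dot w (a ⊕ b) ≡ dot w a + dot w b
dot-⊕ʳ []      []      []      = refl
dot-⊕ʳ (x ∷ w) (y ∷ a) (z ∷ b) =
  trans (cong (λ t → x * (y + z) + t) (dot-⊕ʳ w a b)) (distrib x y z (dot w a) (dot w b))
  where
  distrib : ∀ x y z p q → x * (y + z) + (p + q) ≡ (x * y + p) + (x * z + q)
  distrib = solve-∀

dot-𝟎 : ∀ {n} (w : ZE n) → dot w 𝟎 ≡ 0ℤ
dot-𝟎 []      = refl
dot-𝟎 (x ∷ w) = cong₂ _+_ (ℤP.*-zeroʳ x) (dot-𝟎 w)

e-⊥ : ∀ n → e (⊥ {n}) ≡ 𝟎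
e-⊥ n = VP.map-replicate _ false n

e-⊤ : ∀ n → e (⊤ {n}) ≡ 𝟏
e-⊤ n = VP.map-replicate _ true n

e-∪ : ∀ {n} (C T : Subset n) → C ∩ T ≡ ⊥ → e C ⊕ e T ≡ e (C ∪ T)
e-∪ []          []          _        = refl
e-∪ (true ∷ C)  (true ∷ T)  ()
e-∪ (true ∷ C)  (false ∷ T) disjoint = cong (1ℤ ∷_) (e-∪ C T (VP.∷-injectiveʳ disjoint))
e-∪ (false ∷ C) (true ∷ T)  disjoint = cong (1ℤ ∷_) (e-∪ C T (VP.∷-injectiveʳ disjoint))
e-∪ (false ∷ C) (false ∷ T) disjoint = cong (0ℤ ∷_) (e-∪ C T (VP.∷-injectiveʳ disjoint))

e-∁ : ∀ {n} (I : Subset n) → e (∁ I) ⊕ e I ≡ 𝟏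
e-∁ []          = refl
e-∁ (true ∷ I)  = cong (1ℤ ∷_) (e-∁ I)
e-∁ (false ∷ I) = cong (1ℤ ∷_) (e-∁ I)

dot-e-e : ∀ {n} (A I : Subset n) → dot (e A) (e I) ≡ + ∣ A ∩ I ∣
dot-e-e []          []          = refl
dot-e-e (true ∷ A)  (true ∷ I)  rewrite dot-e-e A I = refl
dot-e-e (true ∷ A)  (false ∷ I) rewrite dot-e-e A I = refl
dot-e-e (false ∷ A) (true ∷ I)  rewrite dot-e-e A I = refl
dot-e-e (false ∷ A) (false ∷ I) rewrite dot-e-e A I = refl

dot-e-𝟏 : ∀ {n} (B : Subset n) → dot (e B) 𝟏 ≡ + ∣ B ∣
dot-e-𝟏 {n} B = begin
  dot (e B) 𝟏      ≡⟨ cong (dot (e B)) (sym (e-⊤ n)) ⟩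
  dot (e B) (e ⊤)  ≡⟨ dot-e-e B ⊤ ⟩
  + ∣ B ∩ ⊤ ∣      ≡⟨ cong (λ X → + ∣ X ∣) (SP.∩-identityʳ B) ⟩
  + ∣ B ∣          ∎
  where open ≡-Reasoning

dot-e-constᵥ : ∀ {n} (B : Subset n) K → dot (e B) (constᵥ K) ≡ + (K ℕ.* ∣ B ∣)
dot-e-constᵥ B zero    = dot-𝟎 (e B)
dot-e-constᵥ B (suc K) = begin
  dot (e B) (constᵥ (suc K))            ≡⟨ cong (dot (e B)) (constᵥ-suc K) ⟩
  dot (e B) (𝟏 ⊕ constᵥ K)              ≡⟨ dot-⊕ʳ (e B) 𝟏 (constᵥ K) ⟩
  dot (e B) 𝟏 + dot (e B) (constᵥ K)    ≡⟨ cong₂ _+_ (dot-e-𝟏 B) (dot-e-constᵥ B K) ⟩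
  + (suc K ℕ.* ∣ B ∣)                   ∎
  where open ≡-Reasoning

dot-eᵢ : ∀ {n} (ω : ZE n) (i : Fin n) → dot ω (e ⁅ i ⁆) ≡ lookup ω i
dot-eᵢ {suc n} (x ∷ ω) Fin.zero = begin
  x * 1ℤ + dot ω (e ⊥)  ≡⟨ cong₂ _+_ (ℤP.*-identityʳ x) (trans (cong (dot ω) (e-⊥ n)) (dot-𝟎 ω)) ⟩
  x + 0ℤ                ≡⟨ ℤP.+-identityʳ x ⟩
  x                     ∎
  where open ≡-Reasoning
dot-eᵢ (x ∷ ω) (Fin.suc i) =
  trans (cong₂ _+_ (ℤP.*-zeroʳ x) (dot-eᵢ ω i)) (ℤP.+-identityˡ (lookup ω i))

isOne : ℤ → Bool
isOne (+ 1) = true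
isOne _     = false

ones : ∀ {n} → ZE n → Subset n
ones = map isOne

zero-one⇒indicator : ∀ {n} (ω : ZE n) → (∀ i → 0ℤ ℤ.≤ lookup ω i) → (∀ i → lookup ω i ℤ.≤ 1ℤ) →
                     ω ≡ e (ones ω)
zero-one⇒indicator []      _      _       = refl
zero-one⇒indicator (x ∷ ω) nonneg atMost1 =
  cong₂ _∷_ (coordinate x (nonneg Fin.zero) (atMost1 Fin.zero))
            (zero-one⇒indicator ω (λ i → nonneg (Fin.suc i)) (λ i → atMost1 (Fin.suc i)))
  where
  coordinate : ∀ x → 0ℤ ℤ.≤ x → x ℤ.≤ 1ℤ → x ≡ (if isOne x then 1ℤ else 0ℤ)
  coordinate (+ 0)           _ _                = refl
  coordinate (+ 1)           _ _                = refl
  coordinate (+ suc (suc m)) _ (+≤+ (ℕ.s≤s ()))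
  coordinate -[1+ m ]        () _

∩-∪-∩∁ : ∀ {n} (B J : Subset n) → B ∩ J ∪ B ∩ ∁ J ≡ B
∩-∪-∩∁ B J = begin
  B ∩ J ∪ B ∩ ∁ J  ≡⟨ sym (SP.∩-distribˡ-∪ B J (∁ J)) ⟩
  B ∩ (J ∪ ∁ J)    ≡⟨ cong (B ∩_) (SP.p∪∁p≡⊤ J) ⟩
  B ∩ ⊤            ≡⟨ SP.∩-identityʳ B ⟩
  B                ∎
  where open ≡-Reasoning

∣∩∣+∣∩∁∣ : ∀ {n} (B J : Subset n) → ∣ B ∩ J ∣ ℕ.+ ∣ B ∩ ∁ J ∣ ≡ ∣ B ∣
∣∩∣+∣∩∁∣ []          []          = refl
∣∩∣+∣∩∁∣ (true ∷ B)  (true ∷ J)  = cong suc (∣∩∣+∣∩∁∣ B J)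
∣∩∣+∣∩∁∣ (true ∷ B)  (false ∷ J) = trans (ℕP.+-suc _ _) (cong suc (∣∩∣+∣∩∁∣ B J))
∣∩∣+∣∩∁∣ (false ∷ B) (j ∷ J)     = ∣∩∣+∣∩∁∣ B J

∣p∪q∣≤∣p∣+∣q∣ : ∀ {n} (p q : Subset n) → ∣ p ∪ q ∣ ℕ.≤ ∣ p ∣ ℕ.+ ∣ q ∣
∣p∪q∣≤∣p∣+∣q∣ []          []          = z≤n
∣p∪q∣≤∣p∣+∣q∣ (true ∷ p)  (true ∷ q)  =
  ℕ.s≤s (ℕP.≤-trans (∣p∪q∣≤∣p∣+∣q∣ p q) (ℕP.+-monoʳ-≤ ∣ p ∣ (ℕP.n≤1+n ∣ q ∣)))
∣p∪q∣≤∣p∣+∣q∣ (true ∷ p)  (false ∷ q) = ℕ.s≤s (∣p∪q∣≤∣p∣+∣q∣ p q)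
∣p∪q∣≤∣p∣+∣q∣ (false ∷ p) (true ∷ q)  =
  subst (suc ∣ p ∪ q ∣ ℕ.≤_) (sym (ℕP.+-suc _ _)) (ℕ.s≤s (∣p∪q∣≤∣p∣+∣q∣ p q))
∣p∪q∣≤∣p∣+∣q∣ (false ∷ p) (false ∷ q) = ∣p∪q∣≤∣p∣+∣q∣ p q

∣B∪x∣≤1+∣B∣ : ∀ {n} (B : Subset n) x → ∣ B ∪ ⁅ x ⁆ ∣ ℕ.≤ suc ∣ B ∣
∣B∪x∣≤1+∣B∣ B x = ℕP.≤-trans (∣p∪q∣≤∣p∣+∣q∣ B ⁅ x ⁆)
  (ℕP.≤-reflexive (trans (cong (∣ B ∣ ℕ.+_) (SP.∣⁅x⁆∣≡1 x)) (ℕP.+-comm ∣ B ∣ 1)))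

⊆-card-antisym : ∀ {n} {B J : Subset n} → B ⊆ J → ∣ J ∣ ℕ.≤ ∣ B ∣ → J ≡ B
⊆-card-antisym {B = []}        {[]}        _   _ = refl
⊆-card-antisym {B = true ∷ B}  {false ∷ J} B⊆J _ with B⊆J here
... | ()
⊆-card-antisym {B = true ∷ B}  {true ∷ J}  B⊆J (ℕ.s≤s J≤B) =
  cong (true ∷_) (⊆-card-antisym (SP.drop-∷-⊆ B⊆J) J≤B)
⊆-card-antisym {B = false ∷ B} {false ∷ J} B⊆J J≤B =
  cong (false ∷_) (⊆-card-antisym (SP.drop-∷-⊆ B⊆J) J≤B)
⊆-card-antisym {B = false ∷ B} {true ∷ J}  B⊆J J≤B =
  contradiction J≤B (ℕP.<⇒≱ (ℕ.s≤s (SP.p⊆q⇒∣p∣≤∣q∣ (SP.drop-∷-⊆ B⊆J))))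

∪-distribˡ-∪ : ∀ {n} (B X Y : Subset n) → B ∪ (X ∪ Y) ≡ (B ∪ X) ∪ (B ∪ Y)
∪-distribˡ-∪ = VP.zipWith-distribˡ ∨-distribˡ-∨
  where
  ∨-distribˡ-∨ : ∀ b x y → b ∨ (x ∨ y) ≡ (b ∨ x) ∨ (b ∨ y)
  ∨-distribˡ-∨ true  _ _ = refl
  ∨-distribˡ-∨ false _ _ = refl

∁-disjoint : ∀ {n} (I J : Subset n) → ∁ I ∩ (J ∩ I) ≡ ⊥
∁-disjoint I J = begin
  ∁ I ∩ (J ∩ I)  ≡⟨ cong (∁ I ∩_) (SP.∩-comm J I) ⟩
  ∁ I ∩ (I ∩ J)  ≡⟨ sym (SP.∩-assoc (∁ I) I J) ⟩
  (∁ I ∩ I) ∩ J  ≡⟨ cong (_∩ J) (SP.∩-inverseˡ I) ⟩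
  ⊥ ∩ J          ≡⟨ SP.∩-zeroˡ J ⟩
  ⊥              ∎
  where open ≡-Reasoning

∁-∪-∩ : ∀ {n} (I J : Subset n) → ∁ I ∪ (J ∩ I) ≡ ∁ I ∪ J
∁-∪-∩ I J = begin
  ∁ I ∪ (J ∩ I)          ≡⟨ SP.∪-distribˡ-∩ (∁ I) J I ⟩
  (∁ I ∪ J) ∩ (∁ I ∪ I)  ≡⟨ cong ((∁ I ∪ J) ∩_) (SP.∪-inverseˡ I) ⟩
  (∁ I ∪ J) ∩ ⊤          ≡⟨ SP.∩-identityʳ _ ⟩
  ∁ I ∪ J                ∎
  where open ≡-Reasoning

∈-⋃ : ∀ {n} {x : Fin n} {X : Subset n} Xs → x ∈ X → X List.∈ Xs → x ∈ ⋃ Xs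
∈-⋃ (Y List.∷ Ys) x∈X (Any.here refl)   = SP.p⊆p∪q (⋃ Ys) x∈X
∈-⋃ (Y List.∷ Ys) x∈X (Any.there X∈Ys) = SP.q⊆p∪q Y (⋃ Ys) (∈-⋃ Ys x∈X X∈Ys)

module _ {n : ℕ} (M : Matroid n) where
  open Matroid M using () renaming (rank to r)

  -- Submodularity together with r(X ∩ Y) ≥ 0.
  rank-subadditive : ∀ X Y → r (X ∪ Y) ℕ.≤ r X ℕ.+ r Y
  rank-subadditive X Y = ℕP.≤-trans (ℕP.m≤m+n _ _) (rank-sub M X Y)

  independent-meets : ∀ B → Independent M B → ∀ J → ∣ B ∩ J ∣ ℕ.≤ r J
  independent-meets B independent J =
    ℕP.≤-trans ∣B∩J∣≤r[B∩J] (rank-mono M (B ∩ J) J (SP.p∩q⊆q B J))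
    where
    open ℕP.≤-Reasoning
    ∣B∩J∣≤r[B∩J] : ∣ B ∩ J ∣ ℕ.≤ r (B ∩ J)
    ∣B∩J∣≤r[B∩J] = ℕP.+-cancelʳ-≤ ∣ B ∩ ∁ J ∣ _ _ (begin
      ∣ B ∩ J ∣ ℕ.+ ∣ B ∩ ∁ J ∣    ≡⟨ ∣∩∣+∣∩∁∣ B J ⟩
      ∣ B ∣                        ≡⟨ sym independent ⟩
      r B                          ≡⟨ cong r (sym (∩-∪-∩∁ B J)) ⟩
      r (B ∩ J ∪ B ∩ ∁ J)          ≤⟨ rank-subadditive (B ∩ J) (B ∩ ∁ J) ⟩
      r (B ∩ J) ℕ.+ r (B ∩ ∁ J)    ≤⟨ ℕP.+-monoʳ-≤ (r (B ∩ J)) (rank-≤ M (B ∩ ∁ J)) ⟩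
      r (B ∩ J) ℕ.+ ∣ B ∩ ∁ J ∣    ∎)

  basis-spans : ∀ B → IsBasis M B → ∀ x → r (B ∪ ⁅ x ⁆) ℕ.≤ r B
  basis-spans B (independent , maximal) x with r (B ∪ ⁅ x ⁆) ℕ.≟ ∣ B ∪ ⁅ x ⁆ ∣
  ... | yes B∪x-independent =
    ℕP.≤-reflexive (cong r (maximal (B ∪ ⁅ x ⁆) (SP.p⊆p∪q ⁅ x ⁆) B∪x-independent))
  ... | no B∪x-dependent = subst (r (B ∪ ⁅ x ⁆) ℕ.≤_) (sym independent)
    (ℕP.≤-pred (ℕP.<-≤-trans (ℕP.≤∧≢⇒< (rank-≤ M (B ∪ ⁅ x ⁆)) B∪x-dependent) (∣B∪x∣≤1+∣B∣ B x)))

  spanned-∪ : ∀ B X Y → r (B ∪ X) ℕ.≤ r B → r (B ∪ Y) ℕ.≤ r B → r (B ∪ (X ∪ Y)) ℕ.≤ r B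
  spanned-∪ B X Y spansX spansY = ℕP.+-cancelʳ-≤ (r B) _ _ (begin
    r (B ∪ (X ∪ Y)) ℕ.+ r B                          ≤⟨ ℕP.+-mono-≤ (ℕP.≤-reflexive (cong r (∪-distribˡ-∪ B X Y)))
                                                                    (rank-mono M B _ B⊆[B∪X]∩[B∪Y]) ⟩
    r ((B ∪ X) ∪ (B ∪ Y)) ℕ.+ r ((B ∪ X) ∩ (B ∪ Y))  ≤⟨ rank-sub M (B ∪ X) (B ∪ Y) ⟩
    r (B ∪ X) ℕ.+ r (B ∪ Y)                          ≤⟨ ℕP.+-mono-≤ spansX spansY ⟩
    r B ℕ.+ r B                                      ∎)
    where
    open ℕP.≤-Reasoning
    B⊆[B∪X]∩[B∪Y] : B ⊆ (B ∪ X) ∩ (B ∪ Y)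
    B⊆[B∪X]∩[B∪Y] x∈B = SP.x∈p∩q⁺ (SP.p⊆p∪q X x∈B , SP.p⊆p∪q Y x∈B)

  basis-size : ∀ B → IsBasis M B → rk M ℕ.≤ ∣ B ∣
  basis-size B basis = begin
    r ⊤                     ≤⟨ rank-mono M ⊤ _ ⊤⊆B∪all ⟩
    r (B ∪ ⋃ (points all))  ≤⟨ spans all ⟩
    r B                     ≡⟨ proj₁ basis ⟩
    ∣ B ∣                   ∎
    where
    open ℕP.≤-Reasoning
    all = List.allFin n
    points : List.List (Fin n) → List.List (Subset n)
    points = List.map ⁅_⁆
    spans : ∀ xs → r (B ∪ ⋃ (points xs)) ℕ.≤ r B
    spans List.[]       = ℕP.≤-reflexive (cong r (SP.∪-identityʳ B))
    spans (x List.∷ xs) = spanned-∪ B ⁅ x ⁆ (⋃ (points xs)) (basis-spans B basis x) (spans xs)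
    ⊤⊆B∪all : ⊤ ⊆ B ∪ ⋃ (points all)
    ⊤⊆B∪all {x} _ = SP.q⊆p∪q B _
      (∈-⋃ (points all) (SP.x∈⁅x⁆ x) (ListP.∈-map⁺ ⁅_⁆ (ListP.∈-allFin x)))

toZ : ∀ {n} → Vec ℕ n → ZE n
toZ = map (λ m → + m)

supp : ∀ {n} → Vec ℕ n → Subset n
supp = map (λ { zero → false ; (suc _) → true })

predᵥ : ∀ {n} → Vec ℕ n → Vec ℕ n
predᵥ = map ℕ.pred

toZ-peel : ∀ {n} (δ : Vec ℕ n) → toZ δ ≡ e (supp δ) ⊕ toZ (predᵥ δ)
toZ-peel []          = refl
toZ-peel (zero ∷ δ)  = cong (+ 0 ∷_) (toZ-peel δ)
toZ-peel (suc m ∷ δ) = cong (+ suc m ∷_) (toZ-peel δ)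

dot-e-predᵥ : ∀ {n} (S : Subset n) (δ : Vec ℕ n) →
              dot (e S) (toZ (predᵥ δ)) ≡ dot (e (S ∩ supp δ)) (toZ (predᵥ δ))
dot-e-predᵥ []          []          = refl
dot-e-predᵥ (false ∷ S) (_ ∷ δ)     rewrite dot-e-predᵥ S δ = refl
dot-e-predᵥ (true ∷ S)  (zero ∷ δ)  rewrite dot-e-predᵥ S δ = refl
dot-e-predᵥ (true ∷ S)  (suc _ ∷ δ) rewrite dot-e-predᵥ S δ = refl

dot-e-peel : ∀ {n} (S : Subset n) (δ : Vec ℕ n) →
             dot (e S) (toZ δ) ≡ + ∣ S ∩ supp δ ∣ + dot (e (S ∩ supp δ)) (toZ (predᵥ δ))
dot-e-peel S δ = begin
  dot (e S) (toZ δ)                             ≡⟨ cong (dot (e S)) (toZ-peel δ) ⟩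
  dot (e S) (e I ⊕ toZ (predᵥ δ))               ≡⟨ dot-⊕ʳ (e S) (e I) (toZ (predᵥ δ)) ⟩
  dot (e S) (e I) + dot (e S) (toZ (predᵥ δ)) ≡⟨ cong₂ _+_ (dot-e-e S I) (dot-e-predᵥ S δ) ⟩
  + ∣ S ∩ I ∣ + dot (e (S ∩ I)) (toZ (predᵥ δ)) ∎
  where
  open ≡-Reasoning
  I = supp δ

All-predᵥ : ∀ {n k} (δ : Vec ℕ n) → All (ℕ._≤ suc k) δ → All (ℕ._≤ k) (predᵥ δ)
All-predᵥ []          []                    = []
All-predᵥ (zero ∷ δ)  (_ ∷ bounded)         = z≤n ∷ All-predᵥ δ bounded
All-predᵥ (suc _ ∷ δ) (ℕ.s≤s m≤k ∷ bounded) = m≤k ∷ All-predᵥ δ bounded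

All-≤0 : ∀ {n} (δ : Vec ℕ n) → All (ℕ._≤ 0) δ → toZ δ ≡ 𝟎
All-≤0 []         []              = refl
All-≤0 (zero ∷ δ) (z≤n ∷ bounded) = cong (0ℤ ∷_) (All-≤0 δ bounded)

maxᵥ : ∀ {n} → Vec ℕ n → ℕ
maxᵥ []      = 0
maxᵥ (x ∷ v) = x ℕ.⊔ maxᵥ v

maxᵥ-bounds : ∀ {n} (v : Vec ℕ n) {k} → maxᵥ v ℕ.≤ k → All (ℕ._≤ k) v
maxᵥ-bounds []      _     = []
maxᵥ-bounds (x ∷ v) max≤k =
  ℕP.≤-trans (ℕP.m≤m⊔n x (maxᵥ v)) max≤k ∷ maxᵥ-bounds v (ℕP.≤-trans (ℕP.m≤n⊔m x (maxᵥ v)) max≤k)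

-- z + K as a natural number, for K ≥ |z|.
shift : ℤ → ℕ → ℕ
shift (+ m)    K = m ℕ.+ K
shift -[1+ m ] K = K ℕ.∸ suc m

shift-correct : ∀ z K → ℤ.∣ z ∣ ℕ.≤ K → + shift z K ≡ z + + K
shift-correct (+ m)    K _      = refl
shift-correct -[1+ m ] K 1+m≤K = sym (ℤP.⊖-≥ 1+m≤K)

maxAbs : ∀ {n} → ZE n → ℕ
maxAbs []      = 0
maxAbs (x ∷ v) = ℤ.∣ x ∣ ℕ.⊔ maxAbs v

reach-within : ∀ {n} K (α β : ZE n) → maxAbs (β ⊟ α) ℕ.≤ K →
               β ⊕ constᵥ K ≡ α ⊕ toZ (zipWith (λ x y → shift (y - x) K) α β)
reach-within K []      []      _     = refl
reach-within K (x ∷ α) (y ∷ β) bound = cong₂ _∷_ coordinate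
  (reach-within K α β (ℕP.≤-trans (ℕP.m≤n⊔m ℤ.∣ y - x ∣ _) bound))
  where
  open ≡-Reasoning
  regroup : ∀ x y k → y + k ≡ x + ((y - x) + k)
  regroup = solve-∀
  coordinate : y + + K ≡ x + + shift (y - x) K
  coordinate = begin
    y + + K                ≡⟨ regroup x y (+ K) ⟩
    x + ((y - x) + + K)    ≡⟨ cong (λ t → x + t) (sym (shift-correct (y - x) K (ℕP.≤-trans (ℕP.m≤m⊔n _ _) bound))) ⟩
    x + + shift (y - x) K  ∎

reach : ∀ {n} (α β : ZE n) → Σ ℕ λ K → Σ (Vec ℕ n) λ δ → β ⊕ constᵥ K ≡ α ⊕ toZ δ
reach α β = K , _ , reach-within K α β ℕP.≤-refl
  where K = maxAbs (β ⊟ α)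

-- Consequences of the increment rule for the potential g of a flock

module FlockPotential {n d : ℕ} (M : ZE n → Matroid n) (flock : IsFlock d M) (g : ZE n → ℤ)
  (g-step : ∀ α I → g (α ⊕ e I) ≡ g α + + rank (M α) I) where

  r : ZE n → Subset n → ℕ
  r α = rank (M α)

  -- Adding e_C and then e_T is adding e_{C ∪ T}; comparing the increments of
  -- g gives r_γ(C) + r_{γ+e_C}(T) = r_γ(C ∪ T) (for C = {i}: contraction).
  rank-chain : ∀ γ C T → C ∩ T ≡ ⊥ → r γ C ℕ.+ r (γ ⊕ e C) T ≡ r γ (C ∪ T)
  rank-chain γ C T disjoint = ℤP.+-injective (+-cancelˡ-≡ (g γ) (begin
    g γ + (+ r γ C + + r (γ ⊕ e C) T)  ≡⟨ sym (ℤP.+-assoc (g γ) (+ r γ C) (+ r (γ ⊕ e C) T)) ⟩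
    g γ + + r γ C + + r (γ ⊕ e C) T    ≡⟨ cong (_+ + r (γ ⊕ e C) T) (sym (g-step γ C)) ⟩
    g (γ ⊕ e C) + + r (γ ⊕ e C) T      ≡⟨ sym (g-step (γ ⊕ e C) T) ⟩
    g ((γ ⊕ e C) ⊕ e T)                ≡⟨ cong g (⊕-assoc γ (e C) (e T)) ⟩
    g (γ ⊕ (e C ⊕ e T))                ≡⟨ cong (λ v → g (γ ⊕ v)) (e-∪ C T disjoint) ⟩
    g (γ ⊕ e (C ∪ T))                  ≡⟨ g-step γ (C ∪ T) ⟩
    g γ + + r γ (C ∪ T)                ∎))
    where open ≡-Reasoning

  -- Writing α = γ + e_{∁I}, so that α + e_I = γ + 𝟏, this is rank-chain for
  -- C = ∁I, T = J ∩ I combined with subadditivity and periodicity.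
  rank-shift : ∀ α I J → r α (J ∩ I) ℕ.≤ r (α ⊕ e I) J
  rank-shift α I J = begin
    r α (J ∩ I)    ≤⟨ ℕP.+-cancelˡ-≤ (r γ (∁ I)) _ _ (ℕP.≤-trans (ℕP.≤-reflexive chain)
                                                                 (rank-subadditive (M γ) (∁ I) J)) ⟩
    r γ J          ≡⟨ flock-period flock γ J ⟩
    r (γ ⊕ 𝟏) J    ≡⟨ cong (λ v → r v J) γ+𝟏≡α+I ⟩
    r (α ⊕ e I) J  ∎
    where
    open ℕP.≤-Reasoning
    γ = α ⊟ e (∁ I)
    γ+𝟏≡α+I : γ ⊕ 𝟏 ≡ α ⊕ e I
    γ+𝟏≡α+I = trans (cong (γ ⊕_) (sym (e-∁ I)))
                (trans (sym (⊕-assoc γ (e (∁ I)) (e I))) (cong (_⊕ e I) (⊟-⊕ α (e (∁ I)))))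
    chain : r γ (∁ I) ℕ.+ r α (J ∩ I) ≡ r γ (∁ I ∪ J)
    chain = subst₂ (λ β X → r γ (∁ I) ℕ.+ r β (J ∩ I) ≡ r γ X) (⊟-⊕ α (e (∁ I))) (∁-∪-∩ I J)
              (rank-chain γ (∁ I) (J ∩ I) (∁-disjoint I J))

  g-period : ∀ β K → g (β ⊕ constᵥ K) ≡ g β + + (K ℕ.* d)
  g-period β zero    = trans (cong g (⊕-identityʳ β)) (sym (ℤP.+-identityʳ (g β)))
  g-period β (suc K) = begin
    g (β ⊕ constᵥ (suc K))  ≡⟨ cong (λ v → g (β ⊕ v)) (constᵥ-suc K) ⟩
    g (β ⊕ (𝟏 ⊕ constᵥ K))  ≡⟨ cong g (sym (⊕-assoc β 𝟏 (constᵥ K))) ⟩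
    g ((β ⊕ 𝟏) ⊕ constᵥ K)  ≡⟨ g-period (β ⊕ 𝟏) K ⟩
    g (β ⊕ 𝟏) + + (K ℕ.* d) ≡⟨ cong (_+ + (K ℕ.* d)) g-step-𝟏 ⟩
    g β + + d + + (K ℕ.* d) ≡⟨ ℤP.+-assoc (g β) (+ d) (+ (K ℕ.* d)) ⟩
    g β + + (suc K ℕ.* d)   ∎
    where
    open ≡-Reasoning
    g-step-𝟏 : g (β ⊕ 𝟏) ≡ g β + + d
    g-step-𝟏 = subst₂ (λ v k → g (β ⊕ v) ≡ g β + + k) (e-⊤ n) (flock-rank flock β) (g-step β ⊤)

  Dominated : ZE n → Subset n → Set
  Dominated α S = ∀ J → ∣ S ∩ J ∣ ℕ.≤ r α J

  dominated-shift : ∀ {α} S I → Dominated α S → Dominated (α ⊕ e I) (S ∩ I)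
  dominated-shift {α} S I dominated J = begin
    ∣ (S ∩ I) ∩ J ∣  ≡⟨ cong ∣_∣ (trans (SP.∩-assoc S I J) (cong (S ∩_) (SP.∩-comm I J))) ⟩
    ∣ S ∩ (J ∩ I) ∣  ≤⟨ dominated (J ∩ I) ⟩
    r α (J ∩ I)      ≤⟨ rank-shift α I J ⟩
    r (α ⊕ e I) J    ∎
    where open ℕP.≤-Reasoning

  dominated-growth-bounded : ∀ k δ → All (ℕ._≤ k) δ → ∀ α S → Dominated α S →
                             g α + dot (e S) (toZ δ) ℤ.≤ g (α ⊕ toZ δ)
  dominated-growth-bounded zero    δ bounded α S _ = ℤP.≤-reflexive (begin
    g α + dot (e S) (toZ δ)  ≡⟨ cong (λ v → g α + dot (e S) v) (All-≤0 δ bounded) ⟩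
    g α + dot (e S) 𝟎        ≡⟨ trans (cong (λ t → g α + t) (dot-𝟎 (e S))) (ℤP.+-identityʳ (g α)) ⟩
    g α                      ≡⟨ cong g (sym (⊕-identityʳ α)) ⟩
    g (α ⊕ 𝟎)                ≡⟨ cong (λ v → g (α ⊕ v)) (sym (All-≤0 δ bounded)) ⟩
    g (α ⊕ toZ δ)            ∎)
    where open ≡-Reasoning
  dominated-growth-bounded (suc k) δ bounded α S dominated = begin
    g α + dot (e S) (toZ δ)                  ≡⟨ cong (λ t → g α + t) (dot-e-peel S δ) ⟩
    g α + (+ ∣ S ∩ I ∣ + dot (e (S ∩ I)) v)  ≤⟨ ℤP.+-monoʳ-≤ (g α) (ℤP.+-monoˡ-≤ (dot (e (S ∩ I)) v) (+≤+ (dominated I))) ⟩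
    g α + (+ r α I + dot (e (S ∩ I)) v)      ≡⟨ sym (ℤP.+-assoc (g α) _ _) ⟩
    g α + + r α I + dot (e (S ∩ I)) v        ≡⟨ cong (_+ dot (e (S ∩ I)) v) (sym (g-step α I)) ⟩
    g (α ⊕ e I) + dot (e (S ∩ I)) v          ≤⟨ dominated-growth-bounded k (predᵥ δ) (All-predᵥ δ bounded) (α ⊕ e I) (S ∩ I)
                                                  (dominated-shift S I dominated) ⟩
    g ((α ⊕ e I) ⊕ v)                        ≡⟨ cong g (⊕-assoc α (e I) v) ⟩
    g (α ⊕ (e I ⊕ v))                        ≡⟨ cong (λ w → g (α ⊕ w)) (sym (toZ-peel δ)) ⟩
    g (α ⊕ toZ δ)                            ∎
    where
    open ℤP.≤-Reasoning
    I = supp δ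
    v = toZ (predᵥ δ)

  dominated-growth : ∀ α S → Dominated α S → ∀ δ → g α + dot (e S) (toZ δ) ℤ.≤ g (α ⊕ toZ δ)
  dominated-growth α S dominated δ =
    dominated-growth-bounded (maxᵥ δ) δ (maxᵥ-bounds δ ℕP.≤-refl) α S dominated

  objective : ZE n → ZE n → ℤ
  objective ω β = dot ω β - g β

  -- Basis ⇒ maximiser: for β + K·𝟏 = α + δ, the growth of g along δ from α
  -- and its periodicity along 𝟏 bound h(β) by h(α), since |B| ≥ d.
  basis⇒maximiser : ∀ α B → IsBasis (M α) B → Maximises (objective (e B)) α
  basis⇒maximiser α B basis β with reach α β
  ... | K , δ , β+K≡α+δ = exchange-bound {a = dot (e B) β} {c = dot (e B) α} {u = g α} {v = g β}
                            translate grow scale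
    where
    open ≡-Reasoning
    translate : dot (e B) β + + (K ℕ.* ∣ B ∣) ≡ dot (e B) α + dot (e B) (toZ δ)
    translate = begin
      dot (e B) β + + (K ℕ.* ∣ B ∣)       ≡⟨ cong (λ t → dot (e B) β + t) (sym (dot-e-constᵥ B K)) ⟩
      dot (e B) β + dot (e B) (constᵥ K)  ≡⟨ sym (dot-⊕ʳ (e B) β (constᵥ K)) ⟩
      dot (e B) (β ⊕ constᵥ K)            ≡⟨ cong (dot (e B)) β+K≡α+δ ⟩
      dot (e B) (α ⊕ toZ δ)               ≡⟨ dot-⊕ʳ (e B) α (toZ δ) ⟩
      dot (e B) α + dot (e B) (toZ δ)     ∎
    grow : g α + dot (e B) (toZ δ) ℤ.≤ g β + + (K ℕ.* d)
    grow = subst (g α + dot (e B) (toZ δ) ℤ.≤_) (trans (cong g (sym β+K≡α+δ)) (g-period β K))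
             (dominated-growth α B (independent-meets (M α) B (proj₁ basis)) δ)
    scale : + (K ℕ.* d) ℤ.≤ + (K ℕ.* ∣ B ∣)
    scale = +≤+ (ℕP.*-monoʳ-≤ K (subst (ℕ._≤ ∣ B ∣) (flock-rank flock α) (basis-size (M α) B basis)))

  objective-step : ∀ ω γ I → objective ω (γ ⊕ e I) + + r γ I ≡ objective ω γ + dot ω (e I)
  objective-step ω γ I = begin
    dot ω (γ ⊕ e I) - g (γ ⊕ e I) + + r γ I                 ≡⟨ cong₂ (λ p q → p - q + + r γ I)
                                                                      (dot-⊕ʳ ω γ (e I)) (g-step γ I) ⟩
    (dot ω γ + dot ω (e I)) - (g γ + + r γ I) + + r γ I     ≡⟨ regroup (dot ω γ) (dot ω (e I)) (g γ) (+ r γ I) ⟩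
    dot ω γ - g γ + dot ω (e I)                             ∎
    where
    open ≡-Reasoning
    regroup : ∀ a w b k → (a + w) - (b + k) + k ≡ a - b + w
    regroup = solve-∀

  maximiser-upper : ∀ ω {α} → Maximises (objective ω) α → ∀ I → dot ω (e I) ℤ.≤ + r α I
  maximiser-upper ω {α} maximum I = +-cancelˡ-≤ (objective ω α) (begin
    objective ω α + dot ω (e I)      ≡⟨ sym (objective-step ω α I) ⟩
    objective ω (α ⊕ e I) + + r α I  ≤⟨ ℤP.+-monoˡ-≤ (+ r α I) (maximum (α ⊕ e I)) ⟩
    objective ω α + + r α I          ∎)
    where open ℤP.≤-Reasoning

  maximiser-lower : ∀ ω {α} → Maximises (objective ω) α → ∀ I → + r (α ⊟ e I) I ℤ.≤ dot ω (e I)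
  maximiser-lower ω {α} maximum I = +-cancelˡ-≤ (objective ω γ) (begin
    objective ω γ + + r γ I          ≤⟨ ℤP.+-monoˡ-≤ (+ r γ I) γ≤α ⟩
    objective ω (γ ⊕ e I) + + r γ I  ≡⟨ objective-step ω γ I ⟩
    objective ω γ + dot ω (e I)      ∎)
    where
    open ℤP.≤-Reasoning
    γ = α ⊟ e I
    γ≤α : objective ω γ ℤ.≤ objective ω (γ ⊕ e I)
    γ≤α = subst (λ β → objective ω γ ℤ.≤ objective ω β) (sym (⊟-⊕ α (e I))) (maximum γ)

  -- Taking I a singleton: a maximiser's weight is 0/1-valued, so ω = e_B.
  maximiser⇒indicator : ∀ ω {α} → Maximises (objective ω) α → ω ≡ e (ones ω)
  maximiser⇒indicator ω {α} maximum = zero-one⇒indicator ω nonneg atMost1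
    where
    nonneg : ∀ i → 0ℤ ℤ.≤ lookup ω i
    nonneg i = subst (0ℤ ℤ.≤_) (dot-eᵢ ω i) (ℤP.≤-trans (+≤+ z≤n) (maximiser-lower ω maximum ⁅ i ⁆))
    atMost1 : ∀ i → lookup ω i ℤ.≤ 1ℤ
    atMost1 i = subst₂ ℤ._≤_ (dot-eᵢ ω i) (cong +_ (SP.∣⁅x⁆∣≡1 i))
                  (ℤP.≤-trans (maximiser-upper ω maximum ⁅ i ⁆) (+≤+ (rank-≤ (M α) ⁅ i ⁆)))

  -- If e_B maximises the objective at α then B is a basis of M_α: I = B gives
  -- independence, I = E gives |B| ≥ d = rk(M_α), which forces maximality.
  indicator-maximiser⇒basis : ∀ {α} B → Maximises (objective (e B)) α → IsBasis (M α) B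
  indicator-maximiser⇒basis {α} B maximum = independent , maximal
    where
    independent : r α B ≡ ∣ B ∣
    independent = ℕP.≤-antisym (rank-≤ (M α) B) (ℤP.drop‿+≤+
      (subst (ℤ._≤ + r α B) (trans (dot-e-e B B) (cong (λ X → + ∣ X ∣) (SP.∩-idem B)))
             (maximiser-upper (e B) maximum B)))
    d≤∣B∣ : d ℕ.≤ ∣ B ∣
    d≤∣B∣ = ℤP.drop‿+≤+ (subst₂ ℤ._≤_ (cong +_ (flock-rank flock (α ⊟ e ⊤)))
      (trans (dot-e-e B ⊤) (cong (λ X → + ∣ X ∣) (SP.∩-identityʳ B))) (maximiser-lower (e B) maximum ⊤))
    maximal : ∀ J → B ⊆ J → Independent (M α) J → J ≡ B
    maximal J B⊆J J-independent = ⊆-card-antisym B⊆J (begin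
      ∣ J ∣    ≡⟨ sym J-independent ⟩
      r α J    ≤⟨ rank-mono (M α) J ⊤ SP.⊆⊤ ⟩
      r α ⊤    ≡⟨ flock-rank flock α ⟩
      d        ≤⟨ d≤∣B∣ ⟩
      ∣ B ∣    ∎)
      where open ℕP.≤-Reasoning

  maximiser⇒basis : ∀ ω {α} → Maximises (objective ω) α → Σ (Subset n) (λ B → IsBasis (M α) B × ω ≡ e B)
  maximiser⇒basis ω {α} maximum = ones ω , indicator-maximiser⇒basis (ones ω) maximum′ , ω≡e
    where
    ω≡e = maximiser⇒indicator ω maximum
    maximum′ = subst (λ w → Maximises (objective w) α) ω≡e maximum

  maximisers : ∀ α ω → Maximises (objective ω) α ⇔ Σ (Subset n) (λ B → IsBasis (M α) B × ω ≡ e B)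
  maximisers α ω = mk⇔ (maximiser⇒basis ω) λ { (B , basis , ω≡e) →
    subst (λ w → Maximises (objective w) α) (sym ω≡e) (basis⇒maximiser α B basis) }

lemma3p9 : {n d : ℕ} (M : ZE n → Matroid n) → IsFlock d M →
    (g : ZE n → ℤ) → g 𝟎 ≡ 0ℤ →
    (∀ α I → g (α ⊕ e I) ≡ g α + + rank (M α) I) →
    (f : ZE n → ℤ∞) → (∀ ω → IsSup (λ β → dot ω β - g β) (f ω)) →
    ∀ α ω → (fin (dot ω α) ≡ f ω +∞ g α) ⇔ Σ (Subset n) (λ B → IsBasis (M α) B × ω ≡ e B)
lemma3p9 M flock g _ g-step f f-sup α ω =
  maximisers α ω ⇔-∘ (sup-attained (f-sup ω) α ⇔-∘ +∞-solve (f ω) (dot ω α) (g α))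
  where open FlockPotential M flock g g-step
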